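{- Let $n\ge 2$ and $\alpha\in\{0,\ldots,n!-2\}$. Then there exist an integer $k\in\{0,\ldots,n-2\}$ and words $A,B$ with $|A|=k+1$ such that \[ p_\alpha=\overline{A}B,\qquad p_{\alpha+1}=BA, \] where juxtaposition denotes concatenation of words and $\overline{A}$ is the reversal of $A$.
   Context: For $m\ge1$, $\mathcal{S}_m$ is the set of permutations (words using each symbol once) of distinct symbols $x_1,\ldots,x_m$, ordered by generation by cyclic shift: $\mathcal{S}_1=((x_1))$, and if $\mathcal{S}_{m-1}=(q_0,\ldots,q_{(m-1)!-1})$ then $\mathcal{S}_m=(p_0,\ldots,p_{m!-1})$ with $p_{m\beta+j}=C^j(q_\beta x_m)$ for $0\le j\le m-1$, where $q_\beta x_m$ appends $x_m$ on the right and $C(c_1c_2\cdots c_m)=(c_2\cdots c_mc_1)$. The reversal of a word $(a_1\cdots a_r)$ is $(a_r\cdots a_1)$. -}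

module Defs where

open import Data.Nat using (ℕ; zero; suc)
open import Data.List using (List; []; _∷_; _++_; [_]; map; concatMap; upTo)
open import Data.Maybe using (Maybe; just; nothing)

-- Symbols x_1, ..., x_m are represented by the natural numbers 1, ..., m.
Word : Set
Word = List ℕ

C : Word → Word
C []       = []
C (c ∷ cs) = cs ++ [ c ]

Cpow : ℕ → Word → Word
Cpow zero    w = w
Cpow (suc j) w = Cpow j (C w)

-- S m : the list (p_0, ..., p_{m!-1}) for m ≥ 1.
-- S 1 = ((x_1)); S (m+1) is obtained from S m = (q_0, ...) by
-- p_{(m+1)β + j} = C^j (q_β x_{m+1}) for 0 ≤ j ≤ m.
-- (S 0 is unused; set to the empty list.)
S : ℕ → List Word
S zero = []
S (suc zero) = [ [ 1 ] ]
S (suc (suc m)) =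
  concatMap (λ q → map (λ j → Cpow j (q ++ [ suc (suc m) ])) (upTo (suc (suc m))))
            (S (suc m))

nth : {A : Set} → List A → ℕ → Maybe A
nth []       _       = nothing
nth (x ∷ xs) zero    = just x
nth (x ∷ xs) (suc i) = nth xs i

-- S (m + 2) is the concatenation, over q in S (m + 1), of the blocks of m + 2 rotations
-- q x, C (q x), ..., x q, where x is the new symbol. Inside a block consecutive words are
-- related with A the first letter (k = 0). At a block boundary, x q is followed by q' x,
-- where q, q' are consecutive in S (m + 1); if q = rev(A) B and q' = B A, then
-- x q = rev(A x) B and q' x = B (A x), so the same A extended by x works with k + 1.
-- Every word of S (m + 1) has length m + 1, which locates the last word of each block.
module Submission where

open import Defs
open import Data.Nat using (ℕ; suc; _≤_; _<_; _∸_; _!)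
open import Data.List using (List; length; reverse; _++_)
open import Data.Maybe using (just)
open import Data.Product using (Σ; _×_)
open import Relation.Binary.PropositionalEquality using (_≡_)

open import Data.Nat using (zero; z≤n; s≤s; _*_; _+_)
open import Data.Nat.Properties using (+-comm; *-comm)
open import Data.List using ([]; _∷_; [_]; last; applyUpTo; concatMap)
open import Data.List.Properties
  using (length-++; length-applyUpTo; ++-assoc; ++-identityʳ; reverse-++; map-upTo; concatMap-cong)
open import Data.List.Relation.Unary.All as All using (All; []; _∷_)
import Data.List.Relation.Unary.All.Properties as Allₚ
open import Data.List.Relation.Unary.Linked using (Linked; []; [-]; _∷_)
import Data.List.Relation.Unary.Linked.Properties as Linkedₚ
open import Data.Maybe.Relation.Binary.Connected using (Connected; just)
open import Data.Product using (_,_)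
open import Relation.Binary.PropositionalEquality
  using (refl; sym; trans; cong; cong₂; subst; module ≡-Reasoning)

length-∷ʳ : ∀ {A : Set} (w : List A) x → length (w ++ [ x ]) ≡ suc (length w)
length-∷ʳ w x = trans (length-++ w) (+-comm (length w) 1)

last-applyUpTo : ∀ {A : Set} (f : ℕ → A) n → last (applyUpTo f (suc n)) ≡ just (f n)
last-applyUpTo f zero    = refl
last-applyUpTo f (suc n) = last-applyUpTo (λ i → f (suc i)) n

length-concatMap-uniform : ∀ {A B : Set} (f : A → List B) {n} → (∀ x → length (f x) ≡ n) →
  ∀ xs → length (concatMap f xs) ≡ length xs * n
length-concatMap-uniform f |f|≡ []       = refl
length-concatMap-uniform f {n} |f|≡ (x ∷ xs) = begin
  length (f x ++ concatMap f xs)          ≡⟨ length-++ (f x) ⟩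
  length (f x) + length (concatMap f xs)  ≡⟨ cong₂ _+_ (|f|≡ x) (length-concatMap-uniform f |f|≡ xs) ⟩
  n + length xs * n                       ∎
  where open ≡-Reasoning

linked-nth : ∀ {A : Set} {R : A → A → Set} {xs} → Linked R xs → ∀ α → suc α < length xs →
  Σ A λ a → Σ A λ b → nth xs α ≡ just a × nth xs (suc α) ≡ just b × R a b
linked-nth [-]                 _       (s≤s ())
linked-nth (_∷_ {x} {y} Rxy _) zero    _       = x , y , refl , refl , Rxy
linked-nth (_ ∷ Rxs)           (suc α) (s≤s α<) = linked-nth Rxs α α<

Cpow-suc : ∀ j w → Cpow (suc j) w ≡ C (Cpow j w)
Cpow-suc zero    w = refl
Cpow-suc (suc j) w = Cpow-suc j (C w)

length-C : ∀ w → length (C w) ≡ length w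
length-C []       = refl
length-C (c ∷ cs) = length-∷ʳ cs c

length-Cpow : ∀ j w → length (Cpow j w) ≡ length w
length-Cpow zero    w = refl
length-Cpow (suc j) w = trans (length-Cpow j (C w)) (length-C w)

Cpow-++ : ∀ u v → Cpow (length u) (u ++ v) ≡ v ++ u
Cpow-++ []      v = sym (++-identityʳ v)
Cpow-++ (c ∷ u) v = begin
  Cpow (length u) ((u ++ v) ++ [ c ])  ≡⟨ cong (Cpow (length u)) (++-assoc u v [ c ]) ⟩
  Cpow (length u) (u ++ (v ++ [ c ]))  ≡⟨ Cpow-++ u (v ++ [ c ]) ⟩
  (v ++ [ c ]) ++ u                    ≡⟨ ++-assoc v [ c ] u ⟩
  v ++ c ∷ u                           ∎
  where open ≡-Reasoning

FlipShift : ℕ → Word → Word → Set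
FlipShift n a b = Σ ℕ λ k → k ≤ n ∸ 2 × Σ Word λ A → Σ Word λ B →
  length A ≡ suc k × a ≡ reverse A ++ B × b ≡ B ++ A

flipShift-C : ∀ {n l} w → length w ≡ suc l → FlipShift n w (C w)
flipShift-C (c ∷ cs) _ = 0 , z≤n , [ c ] , cs , refl , refl , refl

flipShift-∷ʳ : ∀ {m q q′} x → FlipShift (suc (suc m)) q q′ →
  FlipShift (suc (suc (suc m))) (x ∷ q) (q′ ++ [ x ])
flipShift-∷ʳ x (k , k≤m , A , B , |A|≡ , q≡ , q′≡) =
  suc k , s≤s k≤m , A ++ [ x ] , B ,
  trans (length-∷ʳ A x) (cong suc |A|≡) ,
  trans (cong (x ∷_) q≡) (cong (_++ B) (sym (reverse-++ A [ x ]))) ,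
  trans (cong (_++ [ x ]) q′≡) (++-assoc B A [ x ])

rotations : ℕ → Word → List Word
rotations k w = applyUpTo (λ j → Cpow j w) k

linked-rotations : ∀ {n l} k w → length w ≡ suc l → Linked (FlipShift n) (rotations k w)
linked-rotations {n} k w |w|≡ = Linkedₚ.applyUpTo⁺₂ (λ j → Cpow j w) k λ j →
  subst (FlipShift n (Cpow j w)) (sym (Cpow-suc j w))
        (flipShift-C {n} (Cpow j w) (trans (length-Cpow j w) |w|≡))

block : ℕ → Word → List Word
block x q = rotations x (q ++ [ x ])

S-suc : ∀ m → S (suc (suc m)) ≡ concatMap (block (suc (suc m))) (S (suc m))
S-suc m = concatMap-cong (λ q → map-upTo _ (suc (suc m))) (S (suc m))

block-lengths : ∀ {l} x q → length q ≡ l → All (λ w → length w ≡ suc l) (block x q)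
block-lengths x q |q|≡ = Allₚ.applyUpTo⁺₂ (λ j → Cpow j (q ++ [ x ])) x λ j →
  trans (length-Cpow j (q ++ [ x ])) (trans (length-∷ʳ q x) (cong suc |q|≡))

linked-block : ∀ {n l} x q → length q ≡ l → Linked (FlipShift n) (block x q)
linked-block {n} x q |q|≡ =
  linked-rotations {n} x (q ++ [ x ]) (trans (length-∷ʳ q x) (cong suc |q|≡))

last-block : ∀ {l} q → length q ≡ l → last (block (suc l) q) ≡ just (suc l ∷ q)
last-block {l} q refl =
  trans (last-applyUpTo (λ j → Cpow j (q ++ [ suc l ])) l) (cong just (Cpow-++ q [ suc l ]))

linked-blocks : ∀ {m qs} → All (λ q → length q ≡ suc (suc m)) qs →
  Linked (FlipShift (suc (suc m))) qs →
  Linked (FlipShift (suc (suc (suc m)))) (concatMap (block (suc (suc (suc m)))) qs)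
linked-blocks     []            []  = []
linked-blocks {m} (|q|≡ ∷ [])   [-] =
  subst (Linked _) (sym (++-identityʳ _)) (linked-block {suc (suc (suc m))} _ _ |q|≡)
linked-blocks {m} (_∷_ {q} |q|≡ |qs|≡) (_∷_ {y = q′} step steps) =
  Linkedₚ.++⁺ {xs = block x q} (linked-block {x} x q |q|≡) boundary (linked-blocks |qs|≡ steps)
  where
  x = suc (suc (suc m))
  boundary : Connected (FlipShift x) (last (block x q)) (just (q′ ++ [ x ]))
  boundary = subst (λ u → Connected (FlipShift x) u (just (q′ ++ [ x ])))
                   (sym (last-block q |q|≡)) (just (flipShift-∷ʳ {m} x step))

length-S : ∀ m → length (S (suc m)) ≡ suc m !
length-S zero    = refl
length-S (suc m) = begin
  length (S (suc (suc m)))                              ≡⟨ cong length (S-suc m) ⟩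
  length (concatMap (block (suc (suc m))) (S (suc m)))  ≡⟨ length-concatMap-uniform _ |block|≡ (S (suc m)) ⟩
  length (S (suc m)) * suc (suc m)                      ≡⟨ cong (_* suc (suc m)) (length-S m) ⟩
  suc m ! * suc (suc m)                                 ≡⟨ *-comm (suc m !) (suc (suc m)) ⟩
  suc (suc m) !                                         ∎
  where
  open ≡-Reasoning
  |block|≡ : ∀ q → length (block (suc (suc m)) q) ≡ suc (suc m)
  |block|≡ q = length-applyUpTo (λ j → Cpow j (q ++ [ suc (suc m) ])) (suc (suc m))

S-lengths : ∀ m → All (λ w → length w ≡ suc m) (S (suc m))
S-lengths zero    = refl ∷ []
S-lengths (suc m) = subst (All _) (sym (S-suc m))
  (Allₚ.concat⁺ (Allₚ.map⁺ (All.map (block-lengths (suc (suc m)) _) (S-lengths m))))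

-- The induction starts at S 2: flipShift-∷ʳ raises the bound n ∸ 2 by one, which fails at n = 1.
linked-S : ∀ m → Linked (FlipShift (suc (suc m))) (S (suc (suc m)))
linked-S zero    = (0 , z≤n , [ 1 ] , [ 2 ] , refl , refl , refl) ∷ [-]
linked-S (suc m) =
  subst (Linked _) (sym (S-suc (suc m))) (linked-blocks (S-lengths (suc m)) (linked-S m))

proposition14 : (n : ℕ) → 2 ≤ n → (α : ℕ) → suc α < n ! →
    Σ ℕ λ k → k ≤ n ∸ 2 × Σ Word λ A → Σ Word λ B →
      length A ≡ suc k
      × nth (S n) α ≡ just (reverse A ++ B)
      × nth (S n) (suc α) ≡ just (B ++ A)
proposition14 (suc (suc m)) (s≤s (s≤s z≤n)) α α+1<n!
  with linked-nth (linked-S m) α (subst (suc α <_) (sym (length-S (suc m))) α+1<n!)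
... | _ , _ , pα≡ , pα+1≡ , (k , k≤ , A , B , |A|≡ , a≡ , b≡) =
  k , k≤ , A , B , |A|≡ , trans pα≡ (cong just a≡) , trans pα+1≡ (cong just b≡)
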